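{- Let $P$ be a finite poset containing two elements $p<q$, let $r>1$, and let $\imath:[r]\to[2r]$ be strictly increasing. (1) The relation $\preceq_\imath$ on $P_r$ is reflexive if and only if $\imath(t)\in\{2t-1,2t\}$ for all $t\in[r]$. (2) Assume $\imath(1)=1$, and let $b_1,\dots,b_\ell$ and $c_1,\dots,c_\ell$ be the block sizes associated to $\imath$. Then $\preceq_\imath$ is transitive if and only if, writing $\beta_k=b_1+\cdots+b_k$ and $\gamma_k=c_1+\cdots+c_k$ (with $\gamma_0=0$), we have $\beta_k<\gamma_k$ for $1\leq k\leq \ell-1$, $\gamma_k<\beta_{k+1}$ for $1\leq k\leq \ell-2$, and $\gamma_{\ell-1}\leq\beta_\ell\leq\gamma_\ell$; i.e. $b_1<c_1<b_1+b_2<c_1+c_2<\cdots<b_1+\cdots+b_{\ell-1}<c_1+\cdots+c_{\ell-1}\leq b_1+\cdots+b_\ell\leq c_1+\cdots+c_\ell$.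
   Context: For a natural number $n$, $[n]=\{1,\dots,n\}$. $P_r$ is the set of all $r$-multichains $\mathfrak{p}: p_1\leq\cdots\leq p_r$ in $P$. For strictly increasing $\imath:[r]\to[2r]$, $\mathfrak{p}\preceq_\imath\mathfrak{q}$ (for $\mathfrak{p}: p_1\leq\cdots\leq p_r$, $\mathfrak{q}: q_1\leq\cdots\leq q_r$) means: for all $t,s\in[r]$, $p_t\geq q_s$ whenever $s\leq\imath(t)-t$ and $p_t\leq q_s$ whenever $s>\imath(t)-t$. Block sizes: for $\imath$ with $\imath(1)=1$, write the image $\imath([r])$ as a disjoint union $B_1\cup\cdots\cup B_\ell$ of maximal intervals of consecutive integers with $\max B_i+1<\min B_{i+1}$, and set $b_i=|B_i|$. Write the complement $[2r]\setminus\imath([r])$ as a disjoint union $C_1\cup\cdots\cup C_{\ell'}$ of maximal intervals of consecutive integers, increasingly ordered, and set $c_i=|C_i|$; then $\ell'=\ell$ if $2r\notin\imath([r])$ and $\ell'=\ell-1$ if $2r\in\imath([r])$, in which case one sets $c_\ell=0$. (Thus $[2r]$ is the ordered concatenation $B_1,C_1,B_2,C_2,\dots$.) -}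

module Defs where

open import Level using (Level; _⊔_)
open import Data.Nat using (ℕ; zero; suc; _+_; _*_; _∸_; _≤_; _<_; _≡ᵇ_)
open import Data.Bool using (Bool; true; false; if_then_else_; _∧_; _∨_; not)
open import Data.List using (List; []; _∷_; length; take; map)
open import Data.Bool.ListAction using (any)
open import Data.Nat.ListAction using (sum)
open import Data.Fin using (Fin)
open import Data.Product using (Σ; ∃; _×_; _,_)
open import Data.Sum using (_⊎_)
open import Relation.Nullary using (¬_)
open import Relation.Binary.PropositionalEquality using (_≡_)
open import Relation.Binary.Bundles using (Poset)

Finite : ∀ {c ℓ₁ ℓ₂} → Poset c ℓ₁ ℓ₂ → Set (c ⊔ ℓ₁)
Finite P = Σ ℕ λ n → Σ (Fin n → Carrier) λ f → ∀ x → Σ (Fin n) λ i → f i ≈ x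
  where open Poset P renaming (_≤_ to _⊑_)

StrictLt : ∀ {c ℓ₁ ℓ₂} (P : Poset c ℓ₁ ℓ₂) → Poset.Carrier P → Poset.Carrier P → Set (ℓ₁ ⊔ ℓ₂)
StrictLt P p q = (p ⊑ q) × ¬ (p ≈ q)
  where open Poset P renaming (_≤_ to _⊑_)

IsStrictIncMap : ℕ → (ℕ → ℕ) → Set
IsStrictIncMap r ı =
  (∀ t → 1 ≤ t → t ≤ r → 1 ≤ ı t × ı t ≤ 2 * r) ×
  (∀ t → 1 ≤ t → t < r → ı t < ı (suc t))

IsMultichain : ∀ {c ℓ₁ ℓ₂} (P : Poset c ℓ₁ ℓ₂) → ℕ → (ℕ → Poset.Carrier P) → Set ℓ₂
IsMultichain P r 𝔭 = ∀ t → 1 ≤ t → t < r → 𝔭 t ⊑ 𝔭 (suc t)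
  where open Poset P renaming (_≤_ to _⊑_)

Prec : ∀ {c ℓ₁ ℓ₂} (P : Poset c ℓ₁ ℓ₂) → ℕ → (ℕ → ℕ) →
       (ℕ → Poset.Carrier P) → (ℕ → Poset.Carrier P) → Set ℓ₂
Prec P r ı 𝔭 𝔮 = ∀ t s → 1 ≤ t → t ≤ r → 1 ≤ s → s ≤ r →
  (s ≤ ı t ∸ t → 𝔮 s ⊑ 𝔭 t) × (ı t ∸ t < s → 𝔭 t ⊑ 𝔮 s)
  where open Poset P renaming (_≤_ to _⊑_)

PrecReflexive : ∀ {c ℓ₁ ℓ₂} (P : Poset c ℓ₁ ℓ₂) → ℕ → (ℕ → ℕ) → Set (c ⊔ ℓ₂)
PrecReflexive P r ı = ∀ 𝔭 → IsMultichain P r 𝔭 → Prec P r ı 𝔭 𝔭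

PrecTransitive : ∀ {c ℓ₁ ℓ₂} (P : Poset c ℓ₁ ℓ₂) → ℕ → (ℕ → ℕ) → Set (c ⊔ ℓ₂)
PrecTransitive P r ı = ∀ 𝔭 𝔮 𝔯 → IsMultichain P r 𝔭 → IsMultichain P r 𝔮 → IsMultichain P r 𝔯 →
  Prec P r ı 𝔭 𝔮 → Prec P r ı 𝔮 𝔯 → Prec P r ı 𝔭 𝔯

range : ℕ → ℕ → List ℕ
range a zero = []
range a (suc n) = a ∷ range (suc a) n

inImage : ℕ → (ℕ → ℕ) → ℕ → Bool
inImage r ı j = any (λ t → ı t ≡ᵇ j) (range 1 r)

indicator : ℕ → (ℕ → ℕ) → List Bool
indicator r ı = map (inImage r ı) (range 1 (2 * r))

_==ᵇ_ : Bool → Bool → Bool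
x ==ᵇ y = (x ∧ y) ∨ (not x ∧ not y)

runsFrom : Bool → ℕ → List Bool → List ℕ
runsFrom c n [] = n ∷ []
runsFrom c n (y ∷ ys) = if y ==ᵇ c then runsFrom c (suc n) ys else n ∷ runsFrom y 1 ys

runs : List Bool → List ℕ
runs [] = []
runs (x ∷ xs) = runsFrom x 1 xs

evens odds : List ℕ → List ℕ
evens [] = []
evens (x ∷ xs) = x ∷ odds xs
odds [] = []
odds (x ∷ xs) = evens xs

-- b_1,…,b_ℓ  (assuming ı(1)=1 so the word starts with a block B_1)
bSizes : ℕ → (ℕ → ℕ) → List ℕ
bSizes r ı = evens (runs (indicator r ı))

-- c_1,…,c_ℓ, with c_ℓ = 0 appended when 2r ∈ ı([r])
padTo : ℕ → List ℕ → List ℕ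
padTo zero xs = xs
padTo (suc n) [] = 0 ∷ padTo n []
padTo (suc n) (x ∷ xs) = x ∷ padTo n xs

cSizes : ℕ → (ℕ → ℕ) → List ℕ
cSizes r ı = padTo (length (bSizes r ı)) (odds (runs (indicator r ı)))

ℓ-of : ℕ → (ℕ → ℕ) → ℕ
ℓ-of r ı = length (bSizes r ı)

β γ : ℕ → (ℕ → ℕ) → ℕ → ℕ
β r ı k = sum (take k (bSizes r ı))
γ r ı k = sum (take k (cSizes r ı))

BlockCondition : ℕ → (ℕ → ℕ) → Set
BlockCondition r ı =
  (∀ k → 1 ≤ k → k ≤ ℓ ∸ 1 → β r ı k < γ r ı k) ×
  (∀ k → 1 ≤ k → k ≤ ℓ ∸ 2 → γ r ı k < β r ı (suc k)) ×
  (γ r ı (ℓ ∸ 1) ≤ β r ı ℓ) × (β r ı ℓ ≤ γ r ı ℓ)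
  where ℓ = ℓ-of r ı

-- Put δ t = ı t − t; it is non-decreasing with values in [0, r], and 𝔭 ⪯ 𝔮 compares p_t with q_s
-- according as s ≤ δ t or s > δ t. Testing ⪯ on the two-valued multichains p ≤ ⋯ ≤ p ≤ q ≤ ⋯ ≤ q
-- shows that reflexivity means δ t ∈ {t − 1, t}, and that transitivity means that every value m of δ
-- satisfies m ≤ δ m and δ (m + 1) ≤ m; conversely, these two conditions let a comparison of p_t with r_s
-- be routed through q_{δ t} or q_{δ t + 1}. When δ 1 = 0 they say exactly that every jump of δ straddles
-- the diagonal: δ u < u < δ (u + 1). The indicator word of ı([r]) is the concatenation of the words
-- 1 0^{g_t}, where g_t counts the non-values between ı t and ı (t + 1), so that δ (t + 1) = δ t + g_t.
-- A jump of δ ends a block B_k at t = β_k with δ t = γ_{k−1} and δ (t + 1) = γ_k, which turns the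
-- straddling condition into γ_{k−1} < β_k < γ_k; the last inequalities hold since β_ℓ = γ_ℓ = r.

module Submission where

open import Defs
open import Data.Nat using (ℕ; zero; suc; _+_; _*_; _∸_; _<_; _≤_; z≤n; s≤s; z<s; _≤?_; _<?_; _≟_; _≡ᵇ_)
open import Data.Nat.Properties
open import Algebra.Properties.CommutativeSemigroup +-commutativeSemigroup using (x∙yz≈y∙xz)
open import Function.Base using (_∘_)
open import Data.Product using (_×_; _,_; proj₁; proj₂; ∃-syntax)
open import Data.Sum using (_⊎_; inj₁; inj₂)
open import Data.Empty using (⊥-elim)
open import Data.Unit using (⊤; tt)
open import Data.Bool using (Bool; true; false)
open import Data.Bool.Properties using (∨-zeroʳ)
open import Data.Bool.ListAction using (any)
open import Data.List using (List; []; _∷_; length; take; map; replicate; _++_)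
open import Data.List.Properties using (map-++; length-map; length-++; length-replicate)
open import Data.Nat.ListAction using (sum)
open import Function.Bundles using (_⇔_; mk⇔; Equivalence)
open import Function.Construct.Symmetry using (⇔-sym)
open import Function.Related.Propositional using (module EquationalReasoning)
open import Relation.Binary.Bundles using (Poset)
open import Relation.Nullary using (¬_; yes; no)
open import Relation.Nullary.Decidable using (dec-true; dec-false)
open import Relation.Binary.PropositionalEquality
  using (_≡_; _≢_; refl; sym; trans; cong; cong₂; subst; subst₂; module ≡-Reasoning)

crossing : (f : ℕ → ℕ) (m a k : ℕ) → f a < m → m ≤ f (a + k) →
           ∃[ u ] a ≤ u × u < a + k × f u < m × m ≤ f (suc u)
crossing f m a zero fa<m m≤fa = ⊥-elim (<⇒≱ fa<m (subst (λ x → m ≤ f x) (+-identityʳ a) m≤fa))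
crossing f m a (suc k) fa<m m≤fb with m ≤? f (suc a)
... | yes m≤fa+1 = a , ≤-refl , m<m+n a z<s , fa<m , m≤fa+1
... | no m≰fa+1 with crossing f m (suc a) k (≰⇒> m≰fa+1) (subst (λ x → m ≤ f x) (+-suc a k) m≤fb)
...   | u , a<u , u<b , fu<m , m≤fu+1 = u , <⇒≤ a<u , subst (u <_) (sym (+-suc a k)) u<b , fu<m , m≤fu+1

∸-split : ∀ {a b c n} → a + b ≡ c → c ≤ n → n ∸ a ≡ b + (n ∸ c)
∸-split {a} {b} {c} {n} a+b≡c c≤n = begin
  n ∸ a                  ≡⟨ cong (_∸ a) (sym (m+[n∸m]≡n c≤n)) ⟩
  (c + (n ∸ c)) ∸ a      ≡⟨ cong (λ x → (x + (n ∸ c)) ∸ a) (sym a+b≡c) ⟩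
  (a + b + (n ∸ c)) ∸ a  ≡⟨ cong (_∸ a) (+-assoc a b (n ∸ c)) ⟩
  (a + (b + (n ∸ c))) ∸ a ≡⟨ m+n∸m≡n a (b + (n ∸ c)) ⟩
  b + (n ∸ c)            ∎
  where open ≡-Reasoning

range-++ : ∀ a m n → range a (m + n) ≡ range a m ++ range (a + m) n
range-++ a zero    n = cong (λ x → range x n) (sym (+-identityʳ a))
range-++ a (suc m) n = cong (a ∷_) (trans (range-++ (suc a) m n) (cong (λ x → range (suc a) m ++ range x n) (sym (+-suc a m))))

length-range : ∀ a n → length (range a n) ≡ n
length-range a zero    = refl
length-range a (suc n) = cong suc (length-range (suc a) n)

any-range-false : ∀ (p : ℕ → Bool) a n → (∀ u → a ≤ u → u < a + n → p u ≡ false) → any p (range a n) ≡ false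
any-range-false p a zero    _ = refl
any-range-false p a (suc n) h rewrite h a ≤-refl (m<m+n a z<s) =
  any-range-false p (suc a) n (λ u a<u u<b → h u (<⇒≤ a<u) (subst (u <_) (sym (+-suc a n)) u<b))

any-range-true : ∀ (p : ℕ → Bool) a n u → a ≤ u → u < a + n → p u ≡ true → any p (range a n) ≡ true
any-range-true p a zero    u a≤u u<b _ = ⊥-elim (<⇒≱ u<b (subst (_≤ u) (sym (+-identityʳ a)) a≤u))
any-range-true p a (suc n) u a≤u u<b pu with m≤n⇒m<n∨m≡n a≤u
... | inj₂ refl rewrite pu = refl
... | inj₁ a<u rewrite any-range-true p (suc a) n u a<u (subst (u <_) (+-suc a n) u<b) pu = ∨-zeroʳ (p a)

map-range-false : ∀ (p : ℕ → Bool) a n → (∀ u → a ≤ u → u < a + n → p u ≡ false) →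
                  map p (range a n) ≡ replicate n false
map-range-false p a zero    _ = refl
map-range-false p a (suc n) h = cong₂ _∷_ (h a ≤-refl (m<m+n a z<s))
  (map-range-false p (suc a) n (λ u a<u u<b → h u (<⇒≤ a<u) (subst (u <_) (sym (+-suc a n)) u<b)))

gapWord : List ℕ → List Bool
gapWord []       = []
gapWord (g ∷ gs) = true ∷ (replicate g false ++ gapWord gs)

length-gapWord : ∀ gs → length (gapWord gs) ≡ length gs + sum gs
length-gapWord []       = refl
length-gapWord (g ∷ gs) = cong suc (begin
  length (replicate g false ++ gapWord gs)          ≡⟨ length-++ (replicate g false) ⟩
  length (replicate g false) + length (gapWord gs)  ≡⟨ cong₂ _+_ (length-replicate g) (length-gapWord gs) ⟩
  g + (length gs + sum gs)                          ≡⟨ x∙yz≈y∙xz g (length gs) (sum gs) ⟩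
  length gs + (g + sum gs)                          ∎)
  where open ≡-Reasoning

runsFrom-nonEmpty : ∀ c n xs → runsFrom c n xs ≢ []
runsFrom-nonEmpty c n []       ()
runsFrom-nonEmpty c n (y ∷ ys) with y ==ᵇ c
... | true  = runsFrom-nonEmpty c (suc n) ys
... | false = λ ()

runsFrom-falses : ∀ k h gs → runsFrom false k (replicate h false ++ gapWord gs) ≡ k + h ∷ runs (gapWord gs)
runsFrom-falses k zero    []       = cong (_∷ []) (sym (+-identityʳ k))
runsFrom-falses k zero    (g ∷ gs) = cong (_∷ _) (sym (+-identityʳ k))
runsFrom-falses k (suc h) gs       = trans (runsFrom-falses (suc k) h gs) (cong (_∷ runs (gapWord gs)) (sym (+-suc k h)))

-- R lists alternating run lengths b, c, b′, c′, …; B and G are the sums of the runs already read.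
Interlaced : ℕ → ℕ → List ℕ → Set
Interlaced B G (b ∷ c ∷ rest) = (rest ≢ [] → G < B + b × B + b < G + c) × Interlaced (B + b) (G + c) rest
Interlaced B G _              = ⊤

-- Gaps listed from the t-th letter 1 on, D being the number of 0s before that letter.
GapsStraddle : ℕ → ℕ → List ℕ → Set
GapsStraddle t D []            = ⊤
GapsStraddle t D (g ∷ [])      = 0 < g → D < t
GapsStraddle t D (g ∷ g' ∷ gs) = (0 < g → D < t × t < D + g) × GapsStraddle (suc t) (D + g) (g' ∷ gs)

private module _ (B G n g' : ℕ) (gs' : List ℕ) where

  balance-after-1 : B + n + suc (length gs') ≡ G + (0 + sum (g' ∷ gs')) →
                    B + suc n + length gs' ≡ G + sum (g' ∷ gs')
  balance-after-1 inv = trans (cong (_+ length gs') (+-suc B n)) (trans (sym (+-suc (B + n) (length gs'))) inv)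

  balance-after-0s : ∀ h → B + n + suc (length gs') ≡ G + (suc h + sum (g' ∷ gs')) →
                     B + n + 1 + length gs' ≡ G + suc h + sum (g' ∷ gs')
  balance-after-0s h inv = trans (+-assoc (B + n) 1 (length gs')) (trans inv (sym (+-assoc G (suc h) _)))

-- The word is read from inside a block of 1s, of which n are already counted; the hypothesis says
-- that the whole word has as many 1s as 0s.
interlaced⇔gapsStraddle : ∀ gs g B G n → B + n + length gs ≡ G + sum (g ∷ gs) →
  Interlaced B G (runsFrom true n (replicate g false ++ gapWord gs)) ⇔ GapsStraddle (B + n) G (g ∷ gs)
interlaced⇔gapsStraddle []         zero    B G n inv = mk⇔ (λ _ ()) (λ _ → tt)
interlaced⇔gapsStraddle (g' ∷ gs') zero    B G n inv =
  mk⇔ (λ i → (λ ()) , Equivalence.to straddle i) (λ s → Equivalence.from straddle (proj₂ s))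
  where
  R = runsFrom true (suc n) (replicate g' false ++ gapWord gs')
  straddle : Interlaced B G R ⇔ GapsStraddle (suc (B + n)) (G + 0) (g' ∷ gs')
  straddle = subst₂ (λ t D → Interlaced B G R ⇔ GapsStraddle t D (g' ∷ gs')) (+-suc B n) (sym (+-identityʳ G))
               (interlaced⇔gapsStraddle gs' g' B G (suc n) (balance-after-1 B G n g' gs' inv))
interlaced⇔gapsStraddle []         (suc h) B G n inv =
  subst (λ R → Interlaced B G (n ∷ R) ⇔ GapsStraddle (B + n) G (suc h ∷ [])) (sym (runsFrom-falses 1 h []))
    (mk⇔ (λ _ _ → G<B+n) (λ _ → (λ []≢[] → ⊥-elim ([]≢[] refl)) , tt))
  where
  G<B+n : G < B + n
  G<B+n = subst (G <_) (+-identityʳ (B + n)) (subst (G <_) (sym inv) (m<m+n G z<s))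
interlaced⇔gapsStraddle (g' ∷ gs') (suc h) B G n inv =
  subst (λ R → Interlaced B G (n ∷ R) ⇔ GapsStraddle (B + n) G (suc h ∷ g' ∷ gs')) (sym (runsFrom-falses 1 h (g' ∷ gs')))
    (mk⇔ (λ (f , i) → (λ _ → f R'≢[]) , Equivalence.to straddle i)
         (λ (f , s) → (λ _ → f z<s) , Equivalence.from straddle s))
  where
  R' = runsFrom true 1 (replicate g' false ++ gapWord gs')
  R'≢[] : R' ≢ []
  R'≢[] = runsFrom-nonEmpty true 1 (replicate g' false ++ gapWord gs')
  straddle : Interlaced (B + n) (G + suc h) R' ⇔ GapsStraddle (suc (B + n)) (G + suc h) (g' ∷ gs')
  straddle = subst (λ t → Interlaced (B + n) (G + suc h) R' ⇔ GapsStraddle t (G + suc h) (g' ∷ gs')) (+-comm (B + n) 1)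
               (interlaced⇔gapsStraddle gs' g' (B + n) (G + suc h) 1 (balance-after-0s B G n g' gs' h inv))

runs-sum-balanced : ∀ gs g B G n → B + n + length gs ≡ G + sum (g ∷ gs) →
  let R = runsFrom true n (replicate g false ++ gapWord gs) in B + sum (evens R) ≡ G + sum (odds R)
runs-sum-balanced []         zero    B G n inv = trans (sym (+-assoc B n 0)) inv
runs-sum-balanced (g' ∷ gs') zero    B G n inv = runs-sum-balanced gs' g' B G (suc n) (balance-after-1 B G n g' gs' inv)
runs-sum-balanced []         (suc h) B G n inv =
  subst (λ R → B + sum (evens (n ∷ R)) ≡ G + sum (odds (n ∷ R))) (sym (runsFrom-falses 1 h []))
    (trans (sym (+-assoc B n 0)) inv)
runs-sum-balanced (g' ∷ gs') (suc h) B G n inv =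
  subst (λ R → B + sum (evens (n ∷ R)) ≡ G + sum (odds (n ∷ R))) (sym (runsFrom-falses 1 h (g' ∷ gs')))
    (trans (sym (+-assoc B n _))
      (trans (runs-sum-balanced gs' g' (B + n) (G + suc h) 1 (balance-after-0s B G n g' gs' h inv)) (+-assoc G (suc h) _)))

-- For B = G = 0 these are β and γ, so BlockCondition r ı unfolds to
-- BlockConditionFrom 0 0 (runs (indicator r ı)).
blockSum complementSum : ℕ → List ℕ → ℕ → ℕ
blockSum      B R k = B + sum (take k (evens R))
complementSum G R k = G + sum (take k (padTo (length (evens R)) (odds R)))

module _ (B G : ℕ) (R : List ℕ) where
  private ℓ = length (evens R)

  BlocksBelowComplements ComplementsBelowBlocks LastBlockBounds : Set
  BlocksBelowComplements = ∀ k → 1 ≤ k → k ≤ ℓ ∸ 1 → blockSum B R k < complementSum G R k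
  ComplementsBelowBlocks = ∀ k → 1 ≤ k → k ≤ ℓ ∸ 2 → complementSum G R k < blockSum B R (suc k)
  LastBlockBounds        = complementSum G R (ℓ ∸ 1) ≤ blockSum B R ℓ × blockSum B R ℓ ≤ complementSum G R ℓ

FirstBlockAhead : ℕ → ℕ → List ℕ → Set
FirstBlockAhead B G (b ∷ _ ∷ _ ∷ _) = G < B + b
FirstBlockAhead B G _               = ⊤

firstBlockAhead-∷⇔ : ∀ B G b rest → FirstBlockAhead B G (b ∷ rest) ⇔ (1 ≤ length (odds rest) → G < B + b)
firstBlockAhead-∷⇔ B G b []            = mk⇔ (λ _ ()) (λ _ → tt)
firstBlockAhead-∷⇔ B G b (_ ∷ [])      = mk⇔ (λ _ ()) (λ _ → tt)
firstBlockAhead-∷⇔ B G b (_ ∷ _ ∷ _)   = mk⇔ (λ h _ → h) (λ h → h z<s)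

private
  vacuous : ∀ {A : ℕ → Set} k → 1 ≤ k → k ≤ 0 → A k
  vacuous k 1≤k k≤0 = ⊥-elim (1+n≰n (≤-trans 1≤k k≤0))

  ≤∸1⇒< : ∀ {k L} → 1 ≤ k → k ≤ L ∸ 1 → k < L
  ≤∸1⇒< {L = zero}  1≤k k≤0 = ⊥-elim (1+n≰n (≤-trans 1≤k k≤0))
  ≤∸1⇒< {L = suc L} _   k≤L = s≤s k≤L

  <⇒≤∸1 : ∀ {k L} → k < L → k ≤ L ∸ 1
  <⇒≤∸1 {L = suc L} k<L = ≤-pred k<L

InterlacedConditions : ℕ → ℕ → List ℕ → Set
InterlacedConditions B G R = FirstBlockAhead B G R × BlocksBelowComplements B G R × ComplementsBelowBlocks B G R

interlaced⇔-step : ∀ x y z rest B G →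
  Interlaced (B + x) (G + y) (z ∷ rest) ⇔ InterlacedConditions (B + x) (G + y) (z ∷ rest) →
  Interlaced B G (x ∷ y ∷ z ∷ rest) ⇔ InterlacedConditions B G (x ∷ y ∷ z ∷ rest)
interlaced⇔-step x y z rest B G ih = mk⇔ forward backward
  where
  R = x ∷ y ∷ z ∷ rest
  head = firstBlockAhead-∷⇔ (B + x) (G + y) z rest

  forward : Interlaced B G R → InterlacedConditions B G R
  forward (f , i) = proj₁ (f (λ ())) , below₁ , below₂
    where
    h₁ = Equivalence.to ih i
    below₁ : BlocksBelowComplements B G R
    below₁ (suc zero)    _ _  = subst₂ (λ u v → B + u < G + v) (sym (+-identityʳ x)) (sym (+-identityʳ y)) (proj₂ (f (λ ())))
    below₁ (suc (suc k)) _ bd = subst₂ _<_ (+-assoc B x _) (+-assoc G y _) (proj₁ (proj₂ h₁) (suc k) z<s (≤-pred bd))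
    below₂ : ComplementsBelowBlocks B G R
    below₂ (suc zero)    _ bd = subst₂ (λ u v → G + u < v) (sym (+-identityʳ y)) (trans (+-assoc B x z) (cong (λ v → B + (x + v)) (sym (+-identityʳ z))))
                                  (Equivalence.to head (proj₁ h₁) bd)
    below₂ (suc (suc k)) _ bd = subst₂ _<_ (+-assoc G y _) (+-assoc B x _) (proj₂ (proj₂ h₁) (suc k) z<s (<⇒≤∸1 bd))

  backward : InterlacedConditions B G R → Interlaced B G R
  backward (h , below₁ , below₂) =
    (λ _ → h , subst₂ (λ u v → B + u < G + v) (+-identityʳ x) (+-identityʳ y) (below₁ 1 z<s z<s)) ,
    Equivalence.from ih (head′ , (λ k 1≤k bd → subst₂ _<_ (sym (+-assoc B x _)) (sym (+-assoc G y _)) (below₁ (suc k) z<s (s≤s bd)))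
                               , (λ k 1≤k bd → subst₂ _<_ (sym (+-assoc G y _)) (sym (+-assoc B x _)) (below₂ (suc k) z<s (≤∸1⇒< 1≤k bd))))
    where
    head′ : FirstBlockAhead (B + x) (G + y) (z ∷ rest)
    head′ = Equivalence.from head λ bd →
      subst₂ (λ u v → G + u < v) (+-identityʳ y) (trans (cong (λ v → B + (x + v)) (+-identityʳ z)) (sym (+-assoc B x z)))
        (below₂ 1 z<s bd)

interlaced⇔ : ∀ R B G → Interlaced B G R ⇔ InterlacedConditions B G R
interlaced⇔ []                 B G = mk⇔ (λ _ → tt , vacuous , vacuous) (λ _ → tt)
interlaced⇔ (x ∷ [])           B G = mk⇔ (λ _ → tt , vacuous , vacuous) (λ _ → tt)
interlaced⇔ (x ∷ y ∷ [])       B G = mk⇔ (λ _ → tt , vacuous , vacuous) (λ _ → (λ []≢[] → ⊥-elim ([]≢[] refl)) , tt)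
interlaced⇔ (x ∷ y ∷ z ∷ rest) B G = interlaced⇔-step x y z rest B G (interlaced⇔ (z ∷ rest) (B + x) (G + y))

lastBlockBounds : ∀ R B G → R ≢ [] → B + sum (evens R) ≡ G + sum (odds R) → LastBlockBounds B G R
lastBlockBounds []               B G R≢[] _ = ⊥-elim (R≢[] refl)
lastBlockBounds (x ∷ [])         B G _    e = ≤-reflexive (sym e) , ≤-reflexive e
lastBlockBounds (x ∷ y ∷ [])     B G _    e = ≤-trans (+-monoʳ-≤ G z≤n) (≤-reflexive (sym e)) , ≤-reflexive e
lastBlockBounds (x ∷ y ∷ z ∷ rest) B G _  e =
  let (lower , upper) = lastBlockBounds (z ∷ rest) (B + x) (G + y) (λ ()) (trans (+-assoc B x _) (trans e (sym (+-assoc G y _))))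
  in subst₂ _≤_ (+-assoc G y _) (+-assoc B x _) lower , subst₂ _≤_ (+-assoc B x _) (+-assoc G y _) upper

BlockConditionFrom : ℕ → ℕ → List ℕ → Set
BlockConditionFrom B G R = BlocksBelowComplements B G R × ComplementsBelowBlocks B G R × LastBlockBounds B G R

runsFrom-firstBlockAhead : ∀ c n xs → FirstBlockAhead 0 0 (runsFrom c (suc n) xs)
runsFrom-firstBlockAhead c n []       = tt
runsFrom-firstBlockAhead c n (y ∷ ys) with y ==ᵇ c
... | true  = runsFrom-firstBlockAhead c (suc n) ys
... | false = Equivalence.from (firstBlockAhead-∷⇔ 0 0 (suc n) (runsFrom y 1 ys)) (λ _ → z<s)

blockCondition⇔gapsStraddle : ∀ g gs → suc (length gs) ≡ sum (g ∷ gs) →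
  BlockConditionFrom 0 0 (runs (gapWord (g ∷ gs))) ⇔ GapsStraddle 1 0 (g ∷ gs)
blockCondition⇔gapsStraddle g gs balanced = mk⇔
  (λ (below₁ , below₂ , _) →
     Equivalence.to straddle (Equivalence.from interlaced (runsFrom-firstBlockAhead true 0 w , below₁ , below₂)))
  (λ s → let (_ , below₁ , below₂) = Equivalence.to interlaced (Equivalence.from straddle s) in
     below₁ , below₂ , lastBlockBounds R 0 0 (runsFrom-nonEmpty true 1 w) (runs-sum-balanced gs g 0 0 1 balanced))
  where
  w = replicate g false ++ gapWord gs
  R = runsFrom true 1 w
  interlaced = interlaced⇔ R 0 0
  straddle = interlaced⇔gapsStraddle gs g 0 0 1 balanced

module Offset (r : ℕ) (ı : ℕ → ℕ) (inc : IsStrictIncMap r ı) where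

  private
    variable t u v : ℕ

  δ : ℕ → ℕ
  δ t = ı t ∸ t

  ı-spread-+ : ∀ k → 1 ≤ u → u + k ≤ r → ı u + k ≤ ı (u + k)
  ı-spread-+ {u} zero    _   _     = subst₂ _≤_ (sym (+-identityʳ (ı u))) (cong ı (sym (+-identityʳ u))) ≤-refl
  ı-spread-+ {u} (suc k) 1≤u u+k<r = begin
    ı u + suc k      ≡⟨ +-suc (ı u) k ⟩
    suc (ı u + k)    ≤⟨ s≤s (ı-spread-+ k 1≤u (<⇒≤ u+k<r′)) ⟩
    suc (ı (u + k))  ≤⟨ proj₂ inc (u + k) (≤-trans 1≤u (m≤m+n u k)) u+k<r′ ⟩
    ı (suc (u + k))  ≡⟨ cong ı (sym (+-suc u k)) ⟩
    ı (u + suc k)    ∎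
    where
    open ≤-Reasoning
    u+k<r′ : u + k < r
    u+k<r′ = subst (_≤ r) (+-suc u k) u+k<r

  ı-spread : 1 ≤ u → u ≤ v → v ≤ r → ı u + (v ∸ u) ≤ ı v
  ı-spread {u} {v} 1≤u u≤v v≤r = subst (λ w → ı u + (v ∸ u) ≤ ı w) (m+[n∸m]≡n u≤v)
    (ı-spread-+ (v ∸ u) 1≤u (subst (_≤ r) (sym (m+[n∸m]≡n u≤v)) v≤r))

  ı-mono : 1 ≤ u → u ≤ v → v ≤ r → ı u ≤ ı v
  ı-mono {u} {v} 1≤u u≤v v≤r = ≤-trans (m≤m+n (ı u) (v ∸ u)) (ı-spread 1≤u u≤v v≤r)

  ı-bound : 1 ≤ t → t ≤ r → ı t ≤ 2 * r
  ı-bound {t} 1≤t t≤r = proj₂ (proj₁ inc t 1≤t t≤r)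

  t≤ı : 1 ≤ t → t ≤ r → t ≤ ı t
  t≤ı {t} 1≤t t≤r = begin
    t              ≡⟨ sym (m+[n∸m]≡n 1≤t) ⟩
    1 + (t ∸ 1)    ≤⟨ +-monoˡ-≤ (t ∸ 1) (proj₁ (proj₁ inc 1 ≤-refl (≤-trans 1≤t t≤r))) ⟩
    ı 1 + (t ∸ 1)  ≤⟨ ı-spread ≤-refl 1≤t t≤r ⟩
    ı t            ∎
    where open ≤-Reasoning

  ı≡t+δ : 1 ≤ t → t ≤ r → ı t ≡ t + δ t
  ı≡t+δ 1≤t t≤r = sym (m+[n∸m]≡n (t≤ı 1≤t t≤r))

  δ-mono : 1 ≤ u → u ≤ v → v ≤ r → δ u ≤ δ v
  δ-mono {u} {v} 1≤u u≤v v≤r = begin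
    δ u                          ≡⟨ sym ([m+n]∸[m+o]≡n∸o (v ∸ u) (ı u) u) ⟩
    (v ∸ u + ı u) ∸ (v ∸ u + u)  ≡⟨ cong₂ _∸_ (+-comm (v ∸ u) (ı u)) (m∸n+n≡m u≤v) ⟩
    (ı u + (v ∸ u)) ∸ v          ≤⟨ ∸-monoˡ-≤ v (ı-spread 1≤u u≤v v≤r) ⟩
    δ v                          ∎
    where open ≤-Reasoning

  δ≤r : 1 ≤ t → t ≤ r → δ t ≤ r
  δ≤r {t} 1≤t t≤r = begin
    δ t      ≤⟨ δ-mono 1≤t t≤r ≤-refl ⟩
    δ r      ≤⟨ ∸-monoˡ-≤ r (ı-bound (≤-trans 1≤t t≤r) ≤-refl) ⟩
    2 * r ∸ r ≡⟨ trans (m+n∸m≡n r (r + 0)) (+-identityʳ r) ⟩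
    r        ∎
    where open ≤-Reasoning

  ImageAbove ImageBelow : Set
  ImageAbove = ∀ t → 1 ≤ t → t ≤ r → 1 ≤ δ t → δ t ≤ δ (δ t)
  ImageBelow = ∀ t → 1 ≤ t → t ≤ r → δ t < r → δ (suc (δ t)) ≤ δ t

  JumpsStraddleFrom : ℕ → Set
  JumpsStraddleFrom a = ∀ u → a ≤ u → u < r → δ u < δ (suc u) → δ u < u × u < δ (suc u)

  image⇒jumpsStraddle : ImageAbove → ImageBelow → JumpsStraddleFrom 1
  image⇒jumpsStraddle above below u 1≤u u<r jump = δu<u , u<δu+1
    where
    δu+1≤r = δ≤r z<s u<r
    u<δu+1 : u < δ (suc u)
    u<δu+1 with u <? δ (suc u)
    ... | yes u<δu+1 = u<δu+1
    ... | no  u≮δu+1 = ⊥-elim (<⇒≱ jump (≤-trans (above (suc u) z<s u<r (≤-<-trans z≤n jump))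
                                                    (δ-mono (≤-<-trans z≤n jump) (≮⇒≥ u≮δu+1) (<⇒≤ u<r))))
    δu<u : δ u < u
    δu<u with δ u <? u
    ... | yes δu<u = δu<u
    ... | no  δu≮u = ⊥-elim (<⇒≱ jump (≤-trans (δ-mono z<s (s≤s (≮⇒≥ δu≮u)) δu<r) (below u 1≤u (<⇒≤ u<r) δu<r)))
      where δu<r = <-≤-trans jump δu+1≤r

  jumpsStraddle⇒imageAbove : δ 1 ≡ 0 → JumpsStraddleFrom 1 → ImageAbove
  jumpsStraddle⇒imageAbove δ1≡0 jumps t 1≤t t≤r 1≤δt
    with crossing δ (δ t) 1 (t ∸ 1) (subst (_< δ t) (sym δ1≡0) 1≤δt)
                                   (subst (λ x → δ t ≤ δ x) (sym (m+[n∸m]≡n 1≤t)) ≤-refl)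
  ... | u , 1≤u , u<t , δu<δt , δt≤δu+1 = ≤-trans δt≤δu+1 (δ-mono z<s u<δt (δ≤r 1≤t t≤r))
    where
    u<t′ : u < t
    u<t′ = subst (u <_) (m+[n∸m]≡n 1≤t) u<t
    u<δt : u < δ t
    u<δt = ≤-trans (proj₂ (jumps u 1≤u (<-≤-trans u<t′ t≤r) (<-≤-trans δu<δt δt≤δu+1))) (δ-mono z<s u<t′ t≤r)

  jumpsStraddle⇒imageBelow : JumpsStraddleFrom 1 → ImageBelow
  jumpsStraddle⇒imageBelow jumps t 1≤t t≤r δt<r with δ r ≤? δ t
  ... | yes δr≤δt = ≤-trans (δ-mono z<s δt<r ≤-refl) δr≤δt
  ... | no  δr≰δt
    with crossing δ (suc (δ t)) t (r ∸ t) (n<1+n (δ t))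
                 (subst (λ x → suc (δ t) ≤ δ x) (sym (m+[n∸m]≡n t≤r)) (≰⇒> δr≰δt))
  ...   | u , t≤u , u<r , δu<δt+1 , δt<δu+1 = ≤-trans (δ-mono z<s δt<u (<⇒≤ u<r′)) δu≤δt
    where
    u<r′ : u < r
    u<r′ = subst (u <_) (m+[n∸m]≡n t≤r) u<r
    δu≤δt : δ u ≤ δ t
    δu≤δt = ≤-pred δu<δt+1
    δt<u : δ t < u
    δt<u = ≤-<-trans (δ-mono 1≤t t≤u (<⇒≤ u<r′))
             (proj₁ (jumps u (≤-trans 1≤t t≤u) u<r′ (≤-<-trans δu≤δt δt<δu+1)))

  -- 2r + 1 acts as a sentinel closing the gap after ı r.
  next : ℕ → ℕ
  next t with t <? r
  ... | yes _ = ı (suc t)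
  ... | no  _ = suc (2 * r)

  gap : ℕ → ℕ
  gap t = next t ∸ suc (ı t)

  next-< : t < r → next t ≡ ı (suc t)
  next-< {t} t<r with t <? r
  ... | yes _   = refl
  ... | no  t≮r = ⊥-elim (t≮r t<r)

  next-r : next r ≡ suc (2 * r)
  next-r with r <? r
  ... | yes r<r = ⊥-elim (<-irrefl refl r<r)
  ... | no  _   = refl

  ı<next : 1 ≤ t → t ≤ r → ı t < next t
  ı<next {t} 1≤t t≤r with t <? r
  ... | yes t<r = proj₂ inc t 1≤t t<r
  ... | no  _   = s≤s (ı-bound 1≤t t≤r)

  next≤ : 1 ≤ t → next t ≤ suc (2 * r)
  next≤ {t} 1≤t with t <? r
  ... | yes t<r = ≤-trans (ı-bound z<s t<r) (n≤1+n _)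
  ... | no  _   = ≤-refl

  ı+gap≡next : 1 ≤ t → t ≤ r → ı t + suc (gap t) ≡ next t
  ı+gap≡next {t} 1≤t t≤r = trans (+-suc (ı t) (gap t)) (m+[n∸m]≡n (ı<next 1≤t t≤r))

  next≡suc+δ+gap : 1 ≤ t → t ≤ r → next t ≡ suc t + (δ t + gap t)
  next≡suc+δ+gap {t} 1≤t t≤r = begin
    next t                     ≡⟨ sym (ı+gap≡next 1≤t t≤r) ⟩
    ı t + suc (gap t)          ≡⟨ cong (_+ suc (gap t)) (ı≡t+δ 1≤t t≤r) ⟩
    t + δ t + suc (gap t)      ≡⟨ +-suc (t + δ t) (gap t) ⟩
    suc (t + δ t + gap t)      ≡⟨ cong suc (+-assoc t (δ t) (gap t)) ⟩
    suc t + (δ t + gap t)      ∎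
    where open ≡-Reasoning

  δ-step : 1 ≤ t → t < r → δ (suc t) ≡ δ t + gap t
  δ-step {t} 1≤t t<r = +-cancelˡ-≡ (suc t) _ _
    (trans (sym (ı≡t+δ z<s t<r)) (trans (sym (next-< t<r)) (next≡suc+δ+gap 1≤t (<⇒≤ t<r))))

  δ-last : 1 ≤ r → δ r + gap r ≡ r
  δ-last 1≤r = +-cancelˡ-≡ (suc r) _ _
    (trans (sym (next≡suc+δ+gap 1≤r ≤-refl)) (trans next-r (cong (λ x → suc (r + x)) (+-identityʳ r))))

  jump⇔gap : 1 ≤ t → t < r → δ t < δ (suc t) ⇔ 0 < gap t
  jump⇔gap {t} 1≤t t<r rewrite δ-step 1≤t t<r =
    mk⇔ (λ δt<δt+g → +-cancelˡ-< (δ t) 0 (gap t) (subst (_< δ t + gap t) (sym (+-identityʳ (δ t))) δt<δt+g))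
        (m<m+n (δ t))

  χ : ℕ → Bool
  χ = inImage r ı

  χ-ı : 1 ≤ t → t ≤ r → χ (ı t) ≡ true
  χ-ı {t} 1≤t t≤r = any-range-true (λ u → ı u ≡ᵇ ı t) 1 r t 1≤t (s≤s t≤r) (dec-true (ı t ≟ ı t) refl)

  χ-gap : 1 ≤ t → t ≤ r → ∀ j → ı t < j → j < next t → χ j ≡ false
  χ-gap {t} 1≤t t≤r j ıt<j j<next = any-range-false (λ u → ı u ≡ᵇ j) 1 r λ u 1≤u u<r+1 →
    dec-false (ı u ≟ j) (ıu≢j u 1≤u (≤-pred u<r+1))
    where
    ıu≢j : ∀ u → 1 ≤ u → u ≤ r → ı u ≢ j
    ıu≢j u 1≤u u≤r ıu≡j with u ≤? t
    ... | yes u≤t = <-irrefl ıu≡j (≤-<-trans (ı-mono 1≤u u≤t t≤r) ıt<j)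
    ... | no  u≰t = <-irrefl (sym ıu≡j) (<-≤-trans (subst (j <_) (next-< t<r) j<next) (ı-mono z<s t<u u≤r))
      where
      t<u = ≰⇒> u≰t
      t<r = <-≤-trans t<u u≤r

  χ-block : 1 ≤ t → t ≤ r → map χ (range (ı t) (suc (gap t))) ≡ true ∷ replicate (gap t) false
  χ-block {t} 1≤t t≤r = cong₂ _∷_ (χ-ı 1≤t t≤r)
    (map-range-false χ (suc (ı t)) (gap t) λ j ıt<j j<end →
       χ-gap 1≤t t≤r j ıt<j (subst (j <_) (trans (sym (+-suc (ı t) (gap t))) (ı+gap≡next 1≤t t≤r)) j<end))

  suffixWord : ℕ → List Bool
  suffixWord a = map χ (range a (suc (2 * r) ∸ a))

  suffixWord-ı : 1 ≤ t → t ≤ r → suffixWord (ı t) ≡ (true ∷ replicate (gap t) false) ++ suffixWord (next t)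
  suffixWord-ı {t} 1≤t t≤r = begin
    map χ (range (ı t) (suc (2 * r) ∸ ı t))                       ≡⟨ cong (map χ ∘ range (ı t)) length-split ⟩
    map χ (range (ı t) (suc (gap t) + N))                         ≡⟨ cong (map χ) (range-++ (ı t) (suc (gap t)) N) ⟩
    map χ (range (ı t) (suc (gap t)) ++ range (ı t + suc (gap t)) N)   ≡⟨ map-++ χ (range (ı t) (suc (gap t))) _ ⟩
    map χ (range (ı t) (suc (gap t))) ++ map χ (range (ı t + suc (gap t)) N)
      ≡⟨ cong₂ _++_ (χ-block 1≤t t≤r) (cong (λ a → map χ (range a N)) (ı+gap≡next 1≤t t≤r)) ⟩
    (true ∷ replicate (gap t) false) ++ suffixWord (next t)        ∎
    where
    open ≡-Reasoning
    N = suc (2 * r) ∸ next t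
    length-split : suc (2 * r) ∸ ı t ≡ suc (gap t) + N
    length-split = ∸-split (ı+gap≡next 1≤t t≤r) (next≤ 1≤t)

  suffixWord≡gapWord : ∀ k → 1 ≤ t → t + k ≡ r → suffixWord (ı t) ≡ gapWord (map gap (range t (suc k)))
  suffixWord≡gapWord {t} zero 1≤t t+0≡r = trans (suffixWord-ı 1≤t t≤r) (cong ((true ∷ replicate (gap t) false) ++_) end)
    where
    t≡r = trans (sym (+-identityʳ t)) t+0≡r
    t≤r = ≤-reflexive t≡r
    end : suffixWord (next t) ≡ []
    end rewrite t≡r | next-r | n∸n≡0 (2 * r) = refl
  suffixWord≡gapWord {t} (suc k) 1≤t t+k≡r = begin
    suffixWord (ı t)                                                   ≡⟨ suffixWord-ı 1≤t (<⇒≤ t<r) ⟩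
    (true ∷ replicate (gap t) false) ++ suffixWord (next t)            ≡⟨ cong (λ a → block ++ suffixWord a) (next-< t<r) ⟩
    (true ∷ replicate (gap t) false) ++ suffixWord (ı (suc t))
      ≡⟨ cong (block ++_) (suffixWord≡gapWord k z<s (trans (sym (+-suc t k)) t+k≡r)) ⟩
    gapWord (map gap (range t (suc (suc k))))                         ∎
    where
    open ≡-Reasoning
    t<r = subst (t <_) t+k≡r (m<m+n t z<s)
    block = true ∷ replicate (gap t) false

  gaps : List ℕ
  gaps = map gap (range 1 r)

  indicator≡gapWord : ı 1 ≡ 1 → 1 ≤ r → indicator r ı ≡ gapWord gaps
  indicator≡gapWord ı1≡1 1≤r = begin
    suffixWord 1                                      ≡⟨ cong suffixWord (sym ı1≡1) ⟩
    suffixWord (ı 1)                                  ≡⟨ suffixWord≡gapWord (r ∸ 1) ≤-refl (m+[n∸m]≡n 1≤r) ⟩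
    gapWord (map gap (range 1 (1 + (r ∸ 1))))         ≡⟨ cong (λ n → gapWord (map gap (range 1 n))) (m+[n∸m]≡n 1≤r) ⟩
    gapWord gaps                                      ∎
    where open ≡-Reasoning

  length-gaps : length gaps ≡ r
  length-gaps = trans (length-map gap (range 1 r)) (length-range 1 r)

  sum-gaps : ı 1 ≡ 1 → 1 ≤ r → sum gaps ≡ r
  sum-gaps ı1≡1 1≤r = +-cancelˡ-≡ r _ _ (begin
    r + sum gaps                 ≡⟨ cong (_+ sum gaps) (sym length-gaps) ⟩
    length gaps + sum gaps       ≡⟨ sym (length-gapWord gaps) ⟩
    length (gapWord gaps)        ≡⟨ cong length (sym (indicator≡gapWord ı1≡1 1≤r)) ⟩
    length (indicator r ı)       ≡⟨ trans (length-map χ (range 1 (2 * r))) (length-range 1 (2 * r)) ⟩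
    r + (r + 0)                  ≡⟨ cong (r +_) (+-identityʳ r) ⟩
    r + r                        ∎)
    where open ≡-Reasoning

  gapsStraddle⇔jumpsStraddle : ∀ k → 1 ≤ t → t + k ≡ r →
    GapsStraddle t (δ t) (map gap (range t (suc k))) ⇔ JumpsStraddleFrom t
  gapsStraddle⇔jumpsStraddle {t} zero 1≤t t+0≡r =
    mk⇔ (λ _ u t≤u u<r _ → ⊥-elim (<⇒≱ u<r (subst (_≤ u) t≡r t≤u)))
        (λ _ 0<g → subst (λ x → δ x < x) (sym t≡r)
                     (subst (δ r <_) (δ-last (subst (1 ≤_) t≡r 1≤t)) (m<m+n (δ r) (subst (λ x → 0 < gap x) t≡r 0<g))))
    where t≡r = trans (sym (+-identityʳ t)) t+0≡r
  gapsStraddle⇔jumpsStraddle {t} (suc k) 1≤t t+k≡r = mk⇔ forward backward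
    where
    t<r = subst (t <_) t+k≡r (m<m+n t z<s)
    rest = map gap (range (suc t) (suc k))
    ih : GapsStraddle (suc t) (δ t + gap t) rest ⇔ JumpsStraddleFrom (suc t)
    ih = subst (λ D → GapsStraddle (suc t) D rest ⇔ JumpsStraddleFrom (suc t)) (δ-step 1≤t t<r)
           (gapsStraddle⇔jumpsStraddle k z<s (trans (sym (+-suc t k)) t+k≡r))

    forward : GapsStraddle t (δ t) (map gap (range t (suc (suc k)))) → JumpsStraddleFrom t
    forward (here , later) u t≤u u<r jump with m≤n⇒m<n∨m≡n t≤u
    ... | inj₂ refl = let (δt<t , t<δt+g) = here (Equivalence.to (jump⇔gap 1≤t t<r) jump)
                      in δt<t , subst (t <_) (sym (δ-step 1≤t t<r)) t<δt+g
    ... | inj₁ t<u  = Equivalence.to ih later u t<u u<r jump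

    backward : JumpsStraddleFrom t → GapsStraddle t (δ t) (map gap (range t (suc (suc k))))
    backward jumps =
      (λ 0<g → let (δt<t , t<δt+1) = jumps t ≤-refl t<r (Equivalence.from (jump⇔gap 1≤t t<r) 0<g)
               in δt<t , subst (t <_) (δ-step 1≤t t<r) t<δt+1) ,
      Equivalence.from ih (λ u t<u → jumps u (<⇒≤ t<u))

  image⇔jumpsStraddle : δ 1 ≡ 0 → (ImageAbove × ImageBelow) ⇔ JumpsStraddleFrom 1
  image⇔jumpsStraddle δ1≡0 = mk⇔ (λ (above , below) → image⇒jumpsStraddle above below)
    (λ jumps → jumpsStraddle⇒imageAbove δ1≡0 jumps , jumpsStraddle⇒imageBelow jumps)

module _ {c ℓ₁ ℓ₂} (P : Poset c ℓ₁ ℓ₂) where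
  open Poset P using () renaming (_≤_ to _⊑_; refl to ⊑-refl; trans to ⊑-trans)

  multichain-mono : ∀ {r 𝔭 s t} → IsMultichain P r 𝔭 → 1 ≤ s → s ≤ t → t ≤ r → 𝔭 s ⊑ 𝔭 t
  multichain-mono chain 1≤s s≤t t≤r with m≤n⇒m<n∨m≡n s≤t
  ... | inj₂ refl        = ⊑-refl
  ... | inj₁ (s≤s s≤t′) = ⊑-trans (multichain-mono chain 1≤s s≤t′ (<⇒≤ t≤r)) (chain _ (≤-trans 1≤s s≤t′) t≤r)

module Switch {c ℓ₁ ℓ₂} (P : Poset c ℓ₁ ℓ₂) (p q : Poset.Carrier P) (p<q : StrictLt P p q) where
  open Poset P using (Carrier; antisym) renaming (_≤_ to _⊑_; refl to ⊑-refl)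

  switch : ℕ → ℕ → Carrier
  switch a s with s ≤? a
  ... | yes _ = p
  ... | no  _ = q

  switch-≤ : ∀ {a s} → s ≤ a → switch a s ≡ p
  switch-≤ {a} {s} s≤a with s ≤? a
  ... | yes _   = refl
  ... | no  s≰a = ⊥-elim (s≰a s≤a)

  switch-> : ∀ {a s} → ¬ s ≤ a → switch a s ≡ q
  switch-> {a} {s} s≰a with s ≤? a
  ... | yes s≤a = ⊥-elim (s≰a s≤a)
  ... | no  _   = refl

  switch⊑q : ∀ a s → switch a s ⊑ q
  switch⊑q a s with s ≤? a
  ... | yes _ = proj₁ p<q
  ... | no  _ = ⊑-refl

  p⊑switch : ∀ a s → p ⊑ switch a s
  p⊑switch a s with s ≤? a
  ... | yes _ = ⊑-refl
  ... | no  _ = proj₁ p<q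

  switch-mono : ∀ a {s s′} → s ≤ s′ → switch a s ⊑ switch a s′
  switch-mono a {s} {s′} s≤s′ with s′ ≤? a
  ... | yes s′≤a = subst (_⊑ p) (sym (switch-≤ (≤-trans s≤s′ s′≤a))) ⊑-refl
  ... | no  _    = switch⊑q a s

  switch-multichain : ∀ r a → IsMultichain P r (switch a)
  switch-multichain r a t _ _ = switch-mono a (n≤1+n t)

  switch-⋢ : ∀ {a b s t} → ¬ s ≤ b → t ≤ a → ¬ (switch b s ⊑ switch a t)
  switch-⋢ s≰b t≤a q⊑p = proj₂ p<q (antisym (proj₁ p<q) (subst₂ _⊑_ (switch-> s≰b) (switch-≤ t≤a) q⊑p))

  switch-prec : ∀ r ı a b →
    (∀ t → 1 ≤ t → t ≤ r → t ≤ a → ı t ∸ t ≤ b) →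
    (∀ t → 1 ≤ t → t ≤ r → a < t → b ≤ ı t ∸ t) →
    Prec P r ı (switch a) (switch b)
  switch-prec r ı a b low high t s 1≤t t≤r _ _ = below , above
    where
    below : s ≤ ı t ∸ t → switch b s ⊑ switch a t
    below s≤δt with t ≤? a
    ... | yes t≤a = subst (_⊑ p) (sym (switch-≤ (≤-trans s≤δt (low t 1≤t t≤r t≤a)))) ⊑-refl
    ... | no  _   = switch⊑q b s
    above : ı t ∸ t < s → switch a t ⊑ switch b s
    above δt<s with t ≤? a
    ... | yes _   = p⊑switch b s
    ... | no  t≰a = subst (q ⊑_) (sym (switch-> (<⇒≱ (≤-<-trans (high t 1≤t t≤r (≰⇒> t≰a)) δt<s)))) ⊑-refl

module Characterisation {c ℓ₁ ℓ₂} (P : Poset c ℓ₁ ℓ₂) (p q : Poset.Carrier P) (p<q : StrictLt P p q)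
                        (r : ℕ) (ı : ℕ → ℕ) (inc : IsStrictIncMap r ı) where
  open Poset P using () renaming (_≤_ to _⊑_; trans to ⊑-trans)
  open Offset r ı inc
  open Switch P p q p<q

  private
    variable t : ℕ

  NearDiagonal : ℕ → Set
  NearDiagonal t = δ t ≤ t × t ≤ suc (δ t)

  nearDiagonal⇔ : 1 ≤ t → t ≤ r → NearDiagonal t ⇔ ((ı t ≡ 2 * t ∸ 1) ⊎ (ı t ≡ 2 * t))
  nearDiagonal⇔ {suc u} 1≤t t≤r = mk⇔ to from
    where
    ı≡ : ı (suc u) ≡ suc u + δ (suc u)
    ı≡ = ı≡t+δ 1≤t t≤r
    twice∸1 : 2 * suc u ∸ 1 ≡ suc u + u
    twice∸1 = trans (cong (u +_) (+-identityʳ (suc u))) (+-suc u u)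
    twice : 2 * suc u ≡ suc u + suc u
    twice = cong (suc u +_) (+-identityʳ (suc u))

    to : NearDiagonal (suc u) → (ı (suc u) ≡ 2 * suc u ∸ 1) ⊎ (ı (suc u) ≡ 2 * suc u)
    to (δ≤t , t≤δ+1) with m≤n⇒m<n∨m≡n δ≤t
    ... | inj₁ δ<t = inj₁ (trans ı≡ (trans (cong (suc u +_) (≤-antisym (≤-pred δ<t) (≤-pred t≤δ+1))) (sym twice∸1)))
    ... | inj₂ δ≡t = inj₂ (trans ı≡ (trans (cong (suc u +_) δ≡t) (sym twice)))

    from : (ı (suc u) ≡ 2 * suc u ∸ 1) ⊎ (ı (suc u) ≡ 2 * suc u) → NearDiagonal (suc u)
    from (inj₁ ı≡2t∸1) = subst (λ d → d ≤ suc u × suc u ≤ suc d)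
      (sym (+-cancelˡ-≡ (suc u) _ _ (trans (sym ı≡) (trans ı≡2t∸1 twice∸1)))) (n≤1+n u , ≤-refl)
    from (inj₂ ı≡2t)   = subst (λ d → d ≤ suc u × suc u ≤ suc d)
      (sym (+-cancelˡ-≡ (suc u) _ _ (trans (sym ı≡) (trans ı≡2t twice)))) (≤-refl , n≤1+n (suc u))

  reflexive⇒δ≤t : PrecReflexive P r ı → 1 ≤ t → t ≤ r → δ t ≤ t
  reflexive⇒δ≤t {t} reflexive 1≤t t≤r with t <? r | δ t ≤? t
  ... | no  t≮r | _       = ≤-trans (δ≤r 1≤t t≤r) (≮⇒≥ t≮r)
  ... | yes _   | yes δ≤t = δ≤t
  ... | yes t<r | no  δ≰t = ⊥-elim (switch-⋢ 1+n≰n ≤-refl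
      (proj₁ (reflexive (switch t) (switch-multichain r t) t (suc t) 1≤t t≤r z<s t<r) (≰⇒> δ≰t)))

  reflexive⇒t≤δ+1 : PrecReflexive P r ı → 1 ≤ t → t ≤ r → t ≤ suc (δ t)
  reflexive⇒t≤δ+1 {suc u} reflexive 1≤t t≤r with suc u ≤? suc (δ (suc u))
  ... | yes t≤δ+1 = t≤δ+1
  ... | no  t≰δ+1 = ⊥-elim (switch-⋢ 1+n≰n ≤-refl
      (proj₂ (reflexive (switch u) (switch-multichain r u) (suc u) u 1≤t t≤r (≤-<-trans z≤n δ<u) (<⇒≤ t≤r)) δ<u))
    where
    δ<u : δ (suc u) < u
    δ<u = ≤-pred (≰⇒> t≰δ+1)

  nearDiagonal⇒reflexive : (∀ t → 1 ≤ t → t ≤ r → NearDiagonal t) → PrecReflexive P r ı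
  nearDiagonal⇒reflexive near 𝔭 chain t s 1≤t t≤r 1≤s s≤r =
    (λ s≤δt → multichain-mono P chain 1≤s (≤-trans s≤δt (proj₁ (near t 1≤t t≤r))) t≤r) ,
    (λ δt<s → multichain-mono P chain 1≤t (≤-trans (proj₂ (near t 1≤t t≤r)) δt<s) s≤r)

  reflexive⇔ : PrecReflexive P r ı ⇔ (∀ t → 1 ≤ t → t ≤ r → (ı t ≡ 2 * t ∸ 1) ⊎ (ı t ≡ 2 * t))
  reflexive⇔ = mk⇔
    (λ reflexive t 1≤t t≤r → Equivalence.to (nearDiagonal⇔ 1≤t t≤r)
                               (reflexive⇒δ≤t reflexive 1≤t t≤r , reflexive⇒t≤δ+1 reflexive 1≤t t≤r))
    (λ diagonal → nearDiagonal⇒reflexive λ t 1≤t t≤r → Equivalence.from (nearDiagonal⇔ 1≤t t≤r) (diagonal t 1≤t t≤r))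

  -- Compare through q_{δ t}, resp. q_{δ t + 1}.
  image⇒transitive : ImageAbove → ImageBelow → PrecTransitive P r ı
  image⇒transitive above below 𝔭 𝔮 𝔯 _ _ _ 𝔭⪯𝔮 𝔮⪯𝔯 t s 1≤t t≤r 1≤s s≤r = lower , upper
    where
    lower : s ≤ δ t → 𝔯 s ⊑ 𝔭 t
    lower s≤δt = ⊑-trans (proj₁ (𝔮⪯𝔯 (δ t) s 1≤δt δt≤r 1≤s s≤r) (≤-trans s≤δt (above t 1≤t t≤r 1≤δt)))
                         (proj₁ (𝔭⪯𝔮 t (δ t) 1≤t t≤r 1≤δt δt≤r) ≤-refl)
      where
      1≤δt = ≤-trans 1≤s s≤δt
      δt≤r = δ≤r 1≤t t≤r
    upper : δ t < s → 𝔭 t ⊑ 𝔯 s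
    upper δt<s = ⊑-trans (proj₂ (𝔭⪯𝔮 t (suc (δ t)) 1≤t t≤r z<s δt<r) ≤-refl)
                         (proj₂ (𝔮⪯𝔯 (suc (δ t)) s z<s δt<r 1≤s s≤r) (≤-<-trans (below t 1≤t t≤r δt<r) δt<s))
      where
      δt<r = ≤-trans δt<s s≤r

  switch-prec-δ : ∀ {a b} → a ≤ b → b ≤ suc a → 1 ≤ b → b ≤ r → Prec P r ı (switch a) (switch (δ b))
  switch-prec-δ a≤b b≤a+1 1≤b b≤r = switch-prec r ı _ _
    (λ t 1≤t t≤r t≤a → δ-mono 1≤t (≤-trans t≤a a≤b) b≤r)
    (λ t 1≤t t≤r a<t → δ-mono 1≤b (≤-trans b≤a+1 a<t) t≤r)

  transitive⇒imageAbove : PrecTransitive P r ı → ImageAbove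
  transitive⇒imageAbove transitive t 1≤t t≤r 1≤δt with δ t ≤? δ (δ t)
  ... | yes δt≤δδt = δt≤δδt
  ... | no  δt≰δδt = ⊥-elim (switch-⋢ δt≰δδt ≤-refl (proj₁ (𝔭⪯𝔯 t (δ t) 1≤t t≤r 1≤δt δt≤r) ≤-refl))
    where
    δt≤r = δ≤r 1≤t t≤r
    𝔭⪯𝔯 = transitive (switch t) (switch (δ t)) (switch (δ (δ t)))
            (switch-multichain r _) (switch-multichain r _) (switch-multichain r _)
            (switch-prec-δ ≤-refl (n≤1+n t) 1≤t t≤r) (switch-prec-δ ≤-refl (n≤1+n (δ t)) 1≤δt δt≤r)

  transitive⇒imageBelow : PrecTransitive P r ı → ImageBelow
  transitive⇒imageBelow transitive (suc a) 1≤t t≤r δt<r with δ (suc (δ (suc a))) ≤? δ (suc a)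
  ... | yes below = below
  ... | no  above = ⊥-elim (switch-⋢ 1+n≰n (≰⇒> above) (proj₂ (𝔭⪯𝔯 (suc a) (suc m) 1≤t t≤r z<s δt<r) (n<1+n m)))
    where
    m = δ (suc a)
    𝔭⪯𝔯 = transitive (switch a) (switch m) (switch (δ (suc m)))
            (switch-multichain r _) (switch-multichain r _) (switch-multichain r _)
            (switch-prec-δ (n≤1+n a) ≤-refl z<s t≤r) (switch-prec-δ (n≤1+n m) ≤-refl z<s δt<r)

  transitive⇔image : PrecTransitive P r ı ⇔ (ImageAbove × ImageBelow)
  transitive⇔image = mk⇔ (λ transitive → transitive⇒imageAbove transitive , transitive⇒imageBelow transitive)
                         (λ (above , below) → image⇒transitive above below)

-- Writing r = suc r′ makes gaps = gap 1 ∷ ⋯ and r ∸ 1 = r′ hold definitionally.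
transitive⇔blockCondition : ∀ {c ℓ₁ ℓ₂} (P : Poset c ℓ₁ ℓ₂) (p q : Poset.Carrier P) → StrictLt P p q →
  ∀ r′ ı → IsStrictIncMap (suc r′) ı → ı 1 ≡ 1 → PrecTransitive P (suc r′) ı ⇔ BlockCondition (suc r′) ı
transitive⇔blockCondition P p q p<q r′ ı inc ı1≡1 = begin
  PrecTransitive P r ı                          ∼⟨ transitive⇔image ⟩
  (ImageAbove × ImageBelow)                     ∼⟨ image⇔jumpsStraddle δ1≡0 ⟩
  JumpsStraddleFrom 1                           ∼⟨ ⇔-sym (gapsStraddle⇔jumpsStraddle r′ z<s refl) ⟩
  GapsStraddle 1 (δ 1) gaps                     ≡⟨ cong (λ D → GapsStraddle 1 D gaps) δ1≡0 ⟩
  GapsStraddle 1 0 gaps                         ∼⟨ ⇔-sym (blockCondition⇔gapsStraddle (gap 1) _ balanced) ⟩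
  BlockConditionFrom 0 0 (runs (gapWord gaps))  ≡⟨ cong (BlockConditionFrom 0 0 ∘ runs) (sym (indicator≡gapWord ı1≡1 z<s)) ⟩
  BlockCondition r ı                            ∎
  where
  r = suc r′
  open Characterisation P p q p<q r ı inc
  open Offset r ı inc
  open EquationalReasoning
  δ1≡0 : δ 1 ≡ 0
  δ1≡0 = cong (_∸ 1) ı1≡1
  balanced : length gaps ≡ sum gaps
  balanced = trans length-gaps (sym (sum-gaps ı1≡1 z<s))

lemma2p3 : ∀ {c ℓ₁ ℓ₂} (P : Poset c ℓ₁ ℓ₂) → Finite P →
    (p q : Poset.Carrier P) → StrictLt P p q →
    (r : ℕ) → 1 < r → (ı : ℕ → ℕ) → IsStrictIncMap r ı →
    (PrecReflexive P r ı ⇔ (∀ t → 1 ≤ t → t ≤ r → (ı t ≡ 2 * t ∸ 1) ⊎ (ı t ≡ 2 * t)))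
    × (ı 1 ≡ 1 → (PrecTransitive P r ı ⇔ BlockCondition r ı))
lemma2p3 P _ p q p<q (suc r′) _ ı inc =
  Characterisation.reflexive⇔ P p q p<q (suc r′) ı inc , transitive⇔blockCondition P p q p<q r′ ı inc
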